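{- Let $m,n\geq 2$, let $T_n$ be a tree with $n$ vertices, and let $\overline{K_m}$ be the edgeless graph on $m$ vertices. If $n\leq m+1$, then $\chi_L(T_n\odot\overline{K_m})=m+1$.
   Context: All graphs are finite and simple. For a connected graph $G$, a $k$-coloring is a map $c:V(G)\to\{1,\ldots,k\}$ with $c(u)\neq c(v)$ whenever $uv\in E(G)$; it induces the partition $\Pi=\{C_1,\ldots,C_k\}$ into color classes. The color code of $v$ is $c_\Pi(v)=(d(v,C_1),\ldots,d(v,C_k))$, where $d(v,C_i)=\min\{d(v,x): x\in C_i\}$. The coloring is locating if distinct vertices have distinct color codes; $\chi_L(G)$ is the least $k$ admitting a locating $k$-coloring. The corona product $G\odot H$ (for $V(G)=\{a_1,\ldots,a_n\}$) is obtained from one copy of $G$ and $n$ copies of $H$ by joining $a_i$ to every vertex of the $i$-th copy of $H$. -}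

module Defs where

open import Data.Nat using (ℕ; zero; suc; _≤_)
open import Data.Fin using (Fin; inject₁; fromℕ) renaming (zero to fzero; suc to fsuc)
open import Data.Product using (Σ; ∃; _×_; _,_)
open import Data.Sum using (_⊎_; inj₁; inj₂)
open import Data.Empty using (⊥)
open import Relation.Nullary using (¬_)
open import Relation.Binary.PropositionalEquality using (_≡_)
open import Function.Definitions using (Injective)

record Graph (V : Set) : Set₁ where
  field
    Adj   : V → V → Set
    sym   : ∀ {u v} → Adj u v → Adj v u
    irrefl : ∀ {v} → ¬ Adj v v
open Graph public

data Walk {V : Set} (G : Graph V) : V → V → ℕ → Set where
  nil  : ∀ {u} → Walk G u u 0
  cons : ∀ {u w v k} → Adj G u w → Walk G w v k → Walk G u v (suc k)

Connected : {V : Set} → Graph V → Set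
Connected {V} G = ∀ (u v : V) → ∃ λ k → Walk G u v k

-- A cycle: k ≥ 3 distinct vertices f 0, …, f (k-1) with consecutive ones
-- adjacent and f (k-1) adjacent to f 0.
HasCycle : {V : Set} → Graph V → Set
HasCycle {V} G =
  Σ ℕ λ j → Σ (Fin (suc (suc (suc j))) → V) λ f →
    Injective _≡_ _≡_ f
    × (∀ (i : Fin (suc (suc j))) → Adj G (f (inject₁ i)) (f (fsuc i)))
    × Adj G (f (fromℕ (suc (suc j)))) (f fzero)

IsTree : {V : Set} → Graph V → Set
IsTree G = Connected G × ¬ HasCycle G

edgeless : (m : ℕ) → Graph (Fin m)
edgeless m = record { Adj = λ _ _ → ⊥ ; sym = λ () ; irrefl = λ () }

-- Corona product G ⊙ H: vertex inj₁ a is a vertex of G, inj₂ (a , w) is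
-- vertex w of the copy of H attached to a.
coronaAdj : {V W : Set} → Graph V → Graph W → V ⊎ (V × W) → V ⊎ (V × W) → Set
coronaAdj G H (inj₁ a) (inj₁ b) = Adj G a b
coronaAdj G H (inj₁ a) (inj₂ (b , w)) = a ≡ b
coronaAdj G H (inj₂ (a , w)) (inj₁ b) = a ≡ b
coronaAdj G H (inj₂ (a , w)) (inj₂ (b , w')) = (a ≡ b) × Adj H w w'

corona : {V W : Set} → Graph V → Graph W → Graph (V ⊎ (V × W))
corona {V} {W} G H = record { Adj = coronaAdj G H ; sym = λ {u} {v} → s {u} {v} ; irrefl = λ {v} → ir {v} }
  where
  open import Relation.Binary.PropositionalEquality using (refl)
  s : ∀ {u v} → coronaAdj G H u v → coronaAdj G H v u
  s {inj₁ a} {inj₁ b} e = Graph.sym G e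
  s {inj₁ a} {inj₂ (b , w)} refl = refl
  s {inj₂ (a , w)} {inj₁ b} refl = refl
  s {inj₂ (a , w)} {inj₂ (b , w')} (refl , e) = refl , Graph.sym H e
  ir : ∀ {v} → ¬ coronaAdj G H v v
  ir {inj₁ a} e = Graph.irrefl G e
  ir {inj₂ (a , w)} (_ , e) = Graph.irrefl H e

SetDist : {V : Set} → Graph V → V → (V → Set) → ℕ → Set
SetDist G v S d =
  (∃ λ x → S x × Walk G v x d) × (∀ x k → S x → Walk G v x k → d ≤ k)

record Coloring {V : Set} (G : Graph V) (k : ℕ) : Set where
  field
    col    : V → Fin k
    proper : ∀ {u v} → Adj G u v → ¬ (col u ≡ col v)
    onto   : ∀ (i : Fin k) → ∃ λ v → col v ≡ i
open Coloring public

ColorClass : {V : Set} {G : Graph V} {k : ℕ} → Coloring G k → Fin k → V → Set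
ColorClass c i x = col c x ≡ i

SameCode : {V : Set} {G : Graph V} {k : ℕ} → Coloring G k → V → V → Set
SameCode {G = G} {k} c u v =
  ∀ (i : Fin k) (d : ℕ) →
    (SetDist G u (ColorClass c i) d → SetDist G v (ColorClass c i) d)
    × (SetDist G v (ColorClass c i) d → SetDist G u (ColorClass c i) d)

IsLocating : {V : Set} {G : Graph V} {k : ℕ} → Coloring G k → Set
IsLocating {V} c = ∀ (u v : V) → SameCode c u v → u ≡ v

HasLocatingColoring : {V : Set} → Graph V → ℕ → Set
HasLocatingColoring G k = Σ (Coloring G k) IsLocating

LocChromNumber : {V : Set} → Graph V → ℕ → Set
LocChromNumber G k =
  HasLocatingColoring G k × (∀ j → HasLocatingColoring G j → k ≤ j)

-- Lower bound: a hub and its m leaves must receive m + 1 distinct colours.  A hub differs in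
-- colour from its leaves, and two equally coloured leaves of the same hub are exchanged by a
-- colour-preserving automorphism, so they would share their colour code.
-- Upper bound: give the n ≤ m + 1 hubs distinct colours and the leaves of each hub the m colours
-- it does not use.  Then a hub is at distance 1 from every colour but its own, whereas a leaf is
-- at distance 1 only from the colour of its hub; with m + 1 ≥ 3 colours this separates hubs from
-- leaves, and leaves are separated by the colour of their hub and their own colour.
module Submission where

open import Defs hiding (sym)
open import Data.Nat using (ℕ; zero; suc; _≤_; _+_; s≤s; z≤n)
open import Data.Nat.Properties using (+-comm)
open import Data.Fin using (Fin; inject≤; punchIn; punchOut; _≟_)
  renaming (zero to fzero; suc to fsuc)
open import Data.Fin.Properties
  using (inject≤-injective; punchIn-injective; punchInᵢ≢i; punchIn-punchOut; injective⇒≤)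
open import Data.Fin.Permutation using (Permutation′; _⟨$⟩ʳ_; inverseˡ; flip; transpose)
import Data.Fin.Permutation.Components as PC
open import Data.Product using (∃; _×_; _,_; proj₁; proj₂)
open import Data.Sum using (_⊎_; inj₁; inj₂)
open import Data.Empty using (⊥-elim)
open import Function.Base using (_∋_)
open import Function.Definitions using (Injective)
open import Relation.Nullary using (¬_; yes; no)
open import Relation.Binary.PropositionalEquality
  using (_≡_; _≢_; refl; sym; trans; cong; subst; module ≡-Reasoning)

module _ {V : Set} (G : Graph V) where

  Homomorphism : (V → V) → Set
  Homomorphism σ = ∀ {x y} → Adj G x y → Adj G (σ x) (σ y)

  map-Walk : ∀ {σ} → Homomorphism σ → ∀ {u v k} → Walk G u v k → Walk G (σ u) (σ v) k
  map-Walk h nil        = nil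
  map-Walk h (cons e w) = cons (h e) (map-Walk h w)

  Walk₀⇒≡ : ∀ {u v} → Walk G u v 0 → u ≡ v
  Walk₀⇒≡ nil = refl

  record Automorphism : Set where
    field
      to       : V → V
      from     : V → V
      to-hom   : Homomorphism to
      from-hom : Homomorphism from
      from∘to  : ∀ x → from (to x) ≡ x
      to∘from  : ∀ x → to (from x) ≡ x

  inverse : Automorphism → Automorphism
  inverse σ = record
    { to = from ; from = to ; to-hom = from-hom ; from-hom = to-hom
    ; from∘to = to∘from ; to∘from = from∘to }
    where open Automorphism σ

  module _ {k : ℕ} (c : Coloring G k) where

    PreservesColour : Automorphism → Set
    PreservesColour σ = ∀ x → col c (Automorphism.to σ x) ≡ col c x

    inverse-preservesColour : ∀ σ → PreservesColour σ → PreservesColour (inverse σ)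
    inverse-preservesColour σ pres x =
      trans (sym (pres (Automorphism.from σ x))) (cong (col c) (Automorphism.to∘from σ x))

    SetDist-automorphism : ∀ σ → PreservesColour σ → ∀ {u i d} →
      SetDist G u (ColorClass c i) d → SetDist G (Automorphism.to σ u) (ColorClass c i) d
    SetDist-automorphism σ pres {u} ((x , x∈i , w) , shortest) =
      (to x , trans (pres x) x∈i , map-Walk to-hom w) ,
      λ y k y∈i w′ → shortest (from y) k
        (trans (inverse-preservesColour σ pres y) y∈i)
        (subst (λ z → Walk G z (from y) k) (from∘to u) (map-Walk from-hom w′))
      where open Automorphism σ

    SameCode-automorphism : ∀ σ → PreservesColour σ → ∀ u → SameCode c u (Automorphism.to σ u)
    SameCode-automorphism σ pres u i d =
      SetDist-automorphism σ pres ,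
      λ s → subst (λ z → SetDist G z (ColorClass c i) d) (Automorphism.from∘to σ u)
                  (SetDist-automorphism (inverse σ) (inverse-preservesColour σ pres) s)

    IsLocating⇒automorphism-fixes : IsLocating c → ∀ σ → PreservesColour σ →
                                    ∀ u → Automorphism.to σ u ≡ u
    IsLocating⇒automorphism-fixes loc σ pres u = sym (loc u _ (SameCode-automorphism σ pres u))

    SameCode-sym : ∀ {u v} → SameCode c u v → SameCode c v u
    SameCode-sym same i d = proj₂ (same i d) , proj₁ (same i d)

    SameCode⇒≡col : ∀ {u v} → SameCode c u v → col c u ≡ col c v
    SameCode⇒≡col {u} same with proj₁ (same (col c u) 0) ((u , refl , nil) , λ _ _ _ _ → z≤n)
    ... | (x , x∈i , w) , _ = trans (sym x∈i) (cong (col c) (sym (Walk₀⇒≡ w)))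

transpose-preserves : ∀ {m} {A : Set} (f : Fin m → A) {i j} → f i ≡ f j →
                      ∀ k → f (PC.transpose i j k) ≡ f k
transpose-preserves f {i} {j} fi≡fj k with k ≟ i
... | yes refl = sym fi≡fj
... | no _ with k ≟ j
...   | yes refl = fi≡fj
...   | no _ = refl

transpose-sends : ∀ {m} (i j : Fin m) → PC.transpose i j i ≡ j
transpose-sends i j with i ≟ i
... | yes _ = refl
... | no i≢i = ⊥-elim (i≢i refl)

avoid-two : ∀ {m} → 2 ≤ m → (p q : Fin (suc m)) → ∃ λ r → r ≢ p × r ≢ q
avoid-two (s≤s (s≤s _)) p q with q ≟ p
... | yes refl = punchIn p fzero , punchInᵢ≢i p fzero , punchInᵢ≢i p fzero
... | no q≢p =
  punchIn p (punchIn q′ fzero) , punchInᵢ≢i p _ ,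
  λ r≡q → punchInᵢ≢i q′ fzero (punchIn-injective p _ _ (trans r≡q (sym (punchIn-punchOut p≢q))))
  where
  p≢q : p ≢ q
  p≢q p≡q = q≢p (sym p≡q)
  q′ = punchOut p≢q

pattern hub a    = inj₁ a
pattern leaf a w = inj₂ (a , w)

leaf-injective : ∀ {A B : Set} {a : A} {w z : B} → (A ⊎ (A × B) ∋ leaf a w) ≡ leaf a z → w ≡ z
leaf-injective refl = refl

module Corona {n m : ℕ} (T : Graph (Fin n)) where

  G : Graph (Fin n ⊎ (Fin n × Fin m))
  G = corona T (edgeless m)

  permuteAt : Fin n → Permutation′ m → Fin n → Fin m → Fin m
  permuteAt a₀ π a w with a ≟ a₀
  ... | yes _ = π ⟨$⟩ʳ w
  ... | no _  = w

  permuteAt-self : ∀ a π w → permuteAt a π a w ≡ π ⟨$⟩ʳ w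
  permuteAt-self a π w with a ≟ a
  ... | yes _   = refl
  ... | no a≢a = ⊥-elim (a≢a refl)

  permuteAt-inverse : ∀ a₀ π a w → permuteAt a₀ (flip π) a (permuteAt a₀ π a w) ≡ w
  permuteAt-inverse a₀ π a w with a ≟ a₀
  ... | yes _ = inverseˡ π
  ... | no _  = refl

  permuteCopy : Fin n → Permutation′ m → Fin n ⊎ (Fin n × Fin m) → Fin n ⊎ (Fin n × Fin m)
  permuteCopy a₀ π (hub a)    = hub a
  permuteCopy a₀ π (leaf a w) = leaf a (permuteAt a₀ π a w)

  permuteCopy-hom : ∀ a₀ π → Homomorphism G (permuteCopy a₀ π)
  permuteCopy-hom a₀ π {hub a}    {hub b}    e    = e
  permuteCopy-hom a₀ π {hub a}    {leaf b w} refl = refl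
  permuteCopy-hom a₀ π {leaf a w} {hub b}    refl = refl
  permuteCopy-hom a₀ π {leaf a w} {leaf b z} (_ , ())

  permuteCopy-inverse : ∀ a₀ π x → permuteCopy a₀ (flip π) (permuteCopy a₀ π x) ≡ x
  permuteCopy-inverse a₀ π (hub a)    = refl
  permuteCopy-inverse a₀ π (leaf a w) = cong (leaf a) (permuteAt-inverse a₀ π a w)

  permuteCopy-automorphism : Fin n → Permutation′ m → Automorphism G
  permuteCopy-automorphism a₀ π = record
    { to = permuteCopy a₀ π ; from = permuteCopy a₀ (flip π)
    ; to-hom = λ {x} {y} → permuteCopy-hom a₀ π {x} {y}
    ; from-hom = λ {x} {y} → permuteCopy-hom a₀ (flip π) {x} {y}
    ; from∘to = permuteCopy-inverse a₀ π ; to∘from = permuteCopy-inverse a₀ (flip π) }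

  module _ {k : ℕ} (c : Coloring G k) where

    transposeCopy-preservesColour : ∀ a₀ {w w′} → col c (leaf a₀ w) ≡ col c (leaf a₀ w′) →
      PreservesColour G c (permuteCopy-automorphism a₀ (transpose w w′))
    transposeCopy-preservesColour a₀ e (hub a) = refl
    transposeCopy-preservesColour a₀ e (leaf a z) with a ≟ a₀
    ... | yes refl = transpose-preserves (λ w → col c (leaf a w)) e z
    ... | no _     = refl

    leafColour-injective : IsLocating c → ∀ a → Injective _≡_ _≡_ (λ w → col c (leaf a w))
    leafColour-injective loc a {w} {w′} e = sym (begin
      w′                                ≡⟨ sym (transpose-sends w w′) ⟩
      transpose w w′ ⟨$⟩ʳ w              ≡⟨ sym (permuteAt-self a (transpose w w′) w) ⟩
      permuteAt a (transpose w w′) a w  ≡⟨ leaf-injective leaf-fixed ⟩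
      w                                 ∎)
      where
      open ≡-Reasoning
      leaf-fixed : permuteCopy a (transpose w w′) (leaf a w) ≡ leaf a w
      leaf-fixed = IsLocating⇒automorphism-fixes G c loc
                     (permuteCopy-automorphism a (transpose w w′))
                     (transposeCopy-preservesColour a e) (leaf a w)

    closedNeighbourhoodColour : Fin n → Fin (suc m) → Fin k
    closedNeighbourhoodColour a fzero    = col c (hub a)
    closedNeighbourhoodColour a (fsuc w) = col c (leaf a w)

    closedNeighbourhoodColour-injective : IsLocating c → ∀ a →
      Injective _≡_ _≡_ (closedNeighbourhoodColour a)
    closedNeighbourhoodColour-injective loc a {fzero}  {fzero}  e = refl
    closedNeighbourhoodColour-injective loc a {fzero}  {fsuc w} e =
      ⊥-elim (proper c {hub a} {leaf a w} refl e)
    closedNeighbourhoodColour-injective loc a {fsuc w} {fzero}  e =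
      ⊥-elim (proper c {hub a} {leaf a w} refl (sym e))
    closedNeighbourhoodColour-injective loc a {fsuc w} {fsuc z} e =
      cong fsuc (leafColour-injective loc a e)

  locating⇒m<colours : Fin n → ∀ {k} → HasLocatingColoring G k → suc m ≤ k
  locating⇒m<colours a (c , loc) = injective⇒≤ (closedNeighbourhoodColour-injective c loc a)

  leaf-neighbour : ∀ {b w x} → Walk G (leaf b w) x 1 → x ≡ hub b
  leaf-neighbour (cons {w = hub _}  refl nil) = refl
  leaf-neighbour (cons {w = leaf _ _} (_ , ()) _)

  module _ (ι : Fin n → Fin (suc m)) (ι-injective : Injective _≡_ _≡_ ι) (a₀ : Fin n) where

    colour : Fin n ⊎ (Fin n × Fin m) → Fin (suc m)
    colour (hub a)    = ι a
    colour (leaf a w) = punchIn (ι a) w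

    colour-proper : ∀ {u v} → Adj G u v → colour u ≢ colour v
    colour-proper {hub a}    {hub b}    e    eq with ι-injective eq
    ... | refl = irrefl T e
    colour-proper {hub a}    {leaf b w} refl eq = punchInᵢ≢i (ι a) w (sym eq)
    colour-proper {leaf a w} {hub b}    refl eq = punchInᵢ≢i (ι a) w eq
    colour-proper {leaf a w} {leaf b z} (_ , ())

    colour-onto : ∀ i → ∃ λ v → colour v ≡ i
    colour-onto i with i ≟ ι a₀
    ... | yes i≡ιa₀ = hub a₀ , sym i≡ιa₀
    ... | no i≢ιa₀  = leaf a₀ (punchOut (λ ιa₀≡i → i≢ιa₀ (sym ιa₀≡i))) , punchIn-punchOut _

    colouring : Coloring G (suc m)
    colouring = record
      { col = colour ; proper = λ {u} {v} → colour-proper {u} {v} ; onto = colour-onto }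

    at-distance-1 : ∀ {u r} → colour u ≢ r → ∀ x → colour x ≡ r → Walk G u x 1 →
                    SetDist G u (ColorClass colouring r) 1
    at-distance-1 {u} {r} u≢r x x∈r w = (x , x∈r , w) , shortest
      where
      shortest : ∀ y k → colour y ≡ r → Walk G u y k → 1 ≤ k
      shortest y zero    y∈r w₀ with Walk₀⇒≡ G w₀
      ... | refl = ⊥-elim (u≢r y∈r)
      shortest y (suc k) _   _  = s≤s z≤n

    hub-distance : ∀ a {r} → ι a ≢ r → SetDist G (hub a) (ColorClass colouring r) 1
    hub-distance a ιa≢r =
      at-distance-1 ιa≢r (leaf a (punchOut ιa≢r)) (punchIn-punchOut ιa≢r) (cons refl nil)

    leaf-distance : ∀ b w → SetDist G (leaf b w) (ColorClass colouring (ι b)) 1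
    leaf-distance b w = at-distance-1 (punchInᵢ≢i (ι b) w) (hub b) refl (cons refl nil)

    leaf-distance-1 : ∀ b w r → SetDist G (leaf b w) (ColorClass colouring r) 1 → r ≡ ι b
    leaf-distance-1 b w r ((x , x∈r , w₁) , _) with leaf-neighbour w₁
    ... | refl = sym x∈r

    hub≉leaf : 2 ≤ m → ∀ a b w → ¬ SameCode colouring (hub a) (leaf b w)
    hub≉leaf 2≤m a b w same with avoid-two 2≤m (punchIn (ι b) w) (ι b)
    ... | r , r≢leaf , r≢ιb = r≢ιb (leaf-distance-1 b w r (proj₁ (same r 1) (hub-distance a ιa≢r)))
      where
      ιa≢r : ι a ≢ r
      ιa≢r ιa≡r = r≢leaf (trans (sym ιa≡r) (SameCode⇒≡col G colouring same))

    colouring-locating : 2 ≤ m → IsLocating colouring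
    colouring-locating _ (hub a) (hub b) same = cong hub (ι-injective (SameCode⇒≡col G colouring same))
    colouring-locating 2≤m (hub a) (leaf b w) same = ⊥-elim (hub≉leaf 2≤m a b w same)
    colouring-locating 2≤m (leaf a w) (hub b) same =
      ⊥-elim (hub≉leaf 2≤m b a w (SameCode-sym G colouring same))
    colouring-locating _ (leaf a w) (leaf b z) same
      with ι-injective (leaf-distance-1 b z (ι a) (proj₁ (same (ι a) 1) (leaf-distance a w)))
    ... | refl = cong (leaf a) (punchIn-injective (ι a) w z (SameCode⇒≡col G colouring same))

theorem6 : (m n : ℕ) → 2 ≤ m → 2 ≤ n → (T : Graph (Fin n)) → IsTree T →
           n ≤ m + 1 → LocChromNumber (corona T (edgeless m)) (suc m)
theorem6 m zero    _   ()
theorem6 m (suc n) 2≤m _ T _ n≤m+1 =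
  (colouring ι ι-injective fzero , colouring-locating ι ι-injective fzero 2≤m) ,
  λ _ → locating⇒m<colours fzero
  where
  open Corona T
  n≤1+m : suc n ≤ suc m
  n≤1+m = subst (suc n ≤_) (+-comm m 1) n≤m+1
  ι : Fin (suc n) → Fin (suc m)
  ι a = inject≤ a n≤1+m
  ι-injective : Injective _≡_ _≡_ ι
  ι-injective {a} {b} = inject≤-injective n≤1+m n≤1+m a b
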